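{- Let $g$ and $M>1$ be positive integers, let $n_g$ be the number of gapsets of genus $g$, and for integers $q,m$ let $\#\mathcal F(g,q,m)$ be the number of gapsets of genus $g$, depth $q$ and multiplicity $m$. Then, with $k=\left\lceil\frac{2g}{M+1}\right\rceil$, $$n_g\le \mathbf F^{(k)}_{g+1}+\sum_{m=2}^{M}\ \sum_{q=k+1}^{\left\lceil\frac{2g}{m}\right\rceil}\#\mathcal F(g,q,m).$$
   Context: A gapset is a finite set $G\subset\mathbb N$ (positive integers) such that whenever $z\in G$ and $z=x+y$ with $x,y\in\mathbb N$, then $x\in G$ or $y\in G$. Its genus is $\#G$, its multiplicity is $m(G)=\min\{s\in\mathbb N_0\setminus G: s\ne0\}$, its conductor is $c(G)=\min\{s\in\mathbb N_0: s+n\notin G\ \forall n\in\mathbb N_0\}$, and its depth is $\lceil c(G)/m(G)\rceil$. For an integer $k\ge1$, the $k$-generalized Fibonacci sequence is defined by $\mathbf F^{(k)}_1=1$, $\mathbf F^{(k)}_i=0$ for $i\in[-k+2,0]$, and $\mathbf F^{(k)}_n=\sum_{i=1}^k\mathbf F^{(k)}_{n-i}$ for $n\ge2$ (for $k=1$ this gives $\mathbf F^{(1)}_n=1$ for all $n\ge1$); equivalently $\mathbf F^{(k)}_{g+1}$ is the number of compositions of $g$ with all parts in $\{1,\dots,k\}$. -}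

module Defs where

open import Data.Nat using (ℕ; zero; suc; _+_; _*_; _∸_; _<ᵇ_; _≡ᵇ_)
open import Data.Nat.DivMod using (_/_)
open import Data.Bool using (Bool; true; false; _∨_; not; if_then_else_)
open import Data.List using (List; []; _∷_; length; map; filter; take; upTo)
open import Data.Nat.ListAction using (sum)
open import Data.Bool.ListAction using (all; any)
open import Relation.Nullary.Decidable using (Dec; yes; no)
open import Data.Bool using (T)
open import Data.Bool.Properties using (T?)

-- ⌈ a / b ⌉ for b ≥ 1 (value 0 for b = 0, never used)
ceilDiv : ℕ → ℕ → ℕ
ceilDiv a zero    = 0
ceilDiv a (suc b) = (a + b) / suc b

range : ℕ → ℕ → List ℕ
range a b = map (a +_) (upTo (suc b ∸ a))

sumRange : ℕ → ℕ → (ℕ → ℕ) → ℕ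
sumRange a b f = sum (map f (range a b))

-- least s < fuel with p s (returns fuel if none)
leastFrom : (ℕ → Bool) → ℕ → ℕ → ℕ
leastFrom p s zero       = s
leastFrom p s (suc fuel) = if p s then s else leastFrom p (suc s) fuel

-- k-generalized Fibonacci numbers
-- fibSeq k n = [F^(k)_n, F^(k)_(n-1), …, F^(k)_1]; terms with index ≤ 0
-- (i.e. in [-k+2, 0]) are 0, so they contribute nothing to the sum.

fibSeq : ℕ → ℕ → List ℕ
fibSeq k zero          = []
fibSeq k (suc zero)    = 1 ∷ []
fibSeq k (suc (suc n)) with fibSeq k (suc n)
... | l = sum (take k l) ∷ l

-- F k n = F^(k)_n  (for n ≥ 1; F k 0 = 0 = F^(k)_0)
F : ℕ → ℕ → ℕ
F k n with fibSeq k n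
... | []    = 0
... | x ∷ _ = x

-- Finite subsets of ℕ as lists (of distinct elements)

_∈ᵇ_ : ℕ → List ℕ → Bool
x ∈ᵇ G = any (λ y → y ≡ᵇ x) G

sublists : List ℕ → List (List ℕ)
sublists []       = [] ∷ []
sublists (x ∷ xs) = sublists xs Data.List.++ map (x ∷_) (sublists xs)

isGapset : List ℕ → Bool
isGapset G = all (λ z → all (λ x → (x ∈ᵇ G) ∨ ((z ∸ x) ∈ᵇ G)) (range 1 (z ∸ 1))) G

genus : List ℕ → ℕ
genus G = length G

-- multiplicity: least s ≥ 1 with s ∉ G (found among 1 … #G+1)
multiplicity : List ℕ → ℕ
multiplicity G = leastFrom (λ s → not (s ∈ᵇ G)) 1 (suc (length G))

-- conductor: least s ≥ 0 with s + n ∉ G for all n ≥ 0, i.e. every element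
-- of G is < s (found among 0 … ΣG+1)
conductor : List ℕ → ℕ
conductor G = leastFrom (λ s → all (λ z → z <ᵇ s) G) 0 (suc (sum G))

depth : List ℕ → ℕ
depth G = ceilDiv (conductor G) (multiplicity G)

subsetsUpTo : ℕ → List (List ℕ)
subsetsUpTo B = sublists (range 1 B)

nGapsets : ℕ → ℕ → ℕ
nGapsets B g = length (filter (λ G → T? (isGapset G Data.Bool.∧ (genus G ≡ᵇ g))) (subsetsUpTo B))

countF : ℕ → ℕ → ℕ → ℕ → ℕ
countF B g q m = length (filter (λ G → T? (isGapset G Data.Bool.∧ (genus G ≡ᵇ g)
                                            Data.Bool.∧ (depth G ≡ᵇ q)
                                            Data.Bool.∧ (multiplicity G ≡ᵇ m)))
                                (subsetsUpTo B))

-- A gapset G of multiplicity m is determined by its Kunz coordinates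
-- t_r = #{z ∈ G | z ≡ r mod m}, 1 ≤ r < m: since m ∉ G, an element z > m of G
-- forces z − m ∈ G, so the elements of G congruent to r are exactly
-- r, r + m, …, r + (t_r − 1)m.  The t_r are positive and sum to the genus g,
-- and if the depth is at most k then G lies below km, so t_r ≤ k.  Hence the
-- gapsets of genus g and depth ≤ k inject into the compositions of g with parts
-- in {1, …, k}, of which there are F^(k)_(g+1).  Every gapset has conductor
-- c ≤ 2g; so one of larger depth has 2 ≤ m ≤ M (m > M would give
-- c ≤ 2g ≤ k(M + 1) ≤ km, i.e. depth ≤ k) and depth at most ⌈2g/m⌉, and is
-- counted by the double sum.

module Submission where

open import Data.Bool using (Bool; true; false; T; not; _∧_)
open import Data.Bool.ListAction using (all)
open import Data.Bool.Properties using (T?; T-≡; T-not-≡; T-∧; T-∨)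
open import Data.Empty using (⊥; ⊥-elim)
open import Data.List using (List; []; _∷_; length; map; filter; take; upTo; applyUpTo; _++_)
open import Data.List.Membership.Propositional using (_∈_; _∉_; find)
open import Data.List.Membership.Propositional.Properties using (∈-map⁺; ∈-map⁻; ∈-upTo⁺; ∈-upTo⁻; ∈-filter⁺; ∈-filter⁻; ∈-∃++; ∈-++⁻; ∈-++⁺ˡ; ∈-++⁺ʳ)
open import Data.List.Properties using (length-upTo; length-++-sucʳ; length-map; map-cong; map-∘; ∷-injective; ∷-injectiveʳ; map-upTo; take-map)
open import Data.List.Relation.Binary.Subset.Propositional using (_⊆_)
open import Data.List.Relation.Unary.All as All using (All; []; _∷_)
open import Data.List.Relation.Unary.All.Properties using (anti-mono; all⁺; all⁻; ¬All⇒Any¬)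
open import Data.List.Relation.Unary.Any as Any using (here; there)
open import Data.List.Relation.Unary.Any.Properties using (any⁺; any⁻)
open import Data.List.Relation.Unary.Unique.Propositional using (Unique; []; _∷_)
import Data.List.Relation.Unary.Unique.Propositional.Properties as Unique
open import Data.Nat using (ℕ; zero; suc; _+_; _*_; _∸_; _≤_; _<_; z≤n; s≤s; s≤s⁻¹; _≡ᵇ_; _<ᵇ_; _≤ᵇ_; _≤?_; _<?_; _≟_; ⌊_/2⌋; ⌈_/2⌉; pred; >-nonZero; _⊓_)
open import Data.Nat.DivMod using (_%_; _/_; m≡m%n+[m/n]*n; [m+kn]%n≡m%n; m≤n⇒m%n≡m; m%n<n; m<n*o⇒m/o<n; m<n⇒m/n≡0; /-monoˡ-≤)
open import Data.Nat.Induction using (<-wellFounded)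
open import Data.Nat.ListAction using (sum)
open import Data.Nat.Properties
open import Algebra.Properties.CommutativeSemigroup +-commutativeSemigroup using (interchange; x∙yz≈y∙xz)
open import Data.List.Membership.DecPropositional _≟_ using (_∈?_)
open import Data.Product using (∃; _×_; _,_; proj₁; proj₂)
open import Data.Sum using (_⊎_; inj₁; inj₂)
open import Defs
open import Function using (_∘_; case_of_; Equivalence; _⇔_; mk⇔)
open import Induction.WellFounded using (Acc; acc)
open import Relation.Binary.PropositionalEquality using (_≡_; _≢_; refl; sym; trans; cong; cong₂; subst; subst₂; module ≡-Reasoning)
open import Relation.Nullary using (¬_; yes; no; contradiction)

private variable
  A B : Set

InjectiveOn : (A → B) → List A → Set
InjectiveOn f xs = ∀ {x y} → x ∈ xs → y ∈ xs → f x ≡ f y → x ≡ y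

Unique⇒length≤ : {xs ys : List A} → Unique xs → xs ⊆ ys → length xs ≤ length ys
Unique⇒length≤ {xs = []} _ _ = z≤n
Unique⇒length≤ {xs = x ∷ xs} (x∉xs ∷ u) xs⊆ys
  with us , vs , refl ← ∈-∃++ (xs⊆ys (here refl)) =
    subst (suc (length xs) ≤_) (sym (length-++-sucʳ us x vs)) (s≤s (Unique⇒length≤ u xs⊆us++vs))
  where
  xs⊆us++vs : xs ⊆ us ++ vs
  xs⊆us++vs {z} z∈xs with ∈-++⁻ us (xs⊆ys (there z∈xs))
  ... | inj₁ z∈us = ∈-++⁺ˡ z∈us
  ... | inj₂ (here refl) = contradiction refl (All.lookup x∉xs z∈xs)
  ... | inj₂ (there z∈vs) = ∈-++⁺ʳ us z∈vs

Unique-map⁺ : (f : A → B) {xs : List A} → InjectiveOn f xs → Unique xs → Unique (map f xs)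
Unique-map⁺ f {[]} _ [] = []
Unique-map⁺ f {x ∷ xs} inj (x∉xs ∷ u) =
  All.tabulate fx∉ ∷ Unique-map⁺ f (λ p q → inj (there p) (there q)) u
  where
  fx∉ : ∀ {w} → w ∈ map f xs → f x ≢ w
  fx∉ w∈ fx≡w with y , y∈xs , refl ← ∈-map⁻ f w∈ = All.lookup x∉xs y∈xs (inj (here refl) (there y∈xs) fx≡w)

map≡map⇒≡ : ∀ {f g : A → B} {xs x} → map f xs ≡ map g xs → x ∈ xs → f x ≡ g x
map≡map⇒≡ {xs = _ ∷ _} eq (here refl) = proj₁ (∷-injective eq)
map≡map⇒≡ {xs = _ ∷ _} eq (there x∈) = map≡map⇒≡ (proj₂ (∷-injective eq)) x∈

take-upTo : ∀ k n → take k (upTo n) ≡ upTo (k ⊓ n)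
take-upTo zero n = refl
take-upTo (suc k) zero = refl
take-upTo (suc k) (suc n) = cong (0 ∷_) (begin
  take k (applyUpTo suc n)     ≡⟨ cong (take k) (map-upTo suc n) ⟨
  take k (map suc (upTo n))    ≡⟨ take-map k (upTo n) ⟩
  map suc (take k (upTo n))    ≡⟨ cong (map suc) (take-upTo k n) ⟩
  map suc (upTo (k ⊓ n))       ≡⟨ map-upTo suc (k ⊓ n) ⟩
  applyUpTo suc (k ⊓ n)        ∎)
  where open ≡-Reasoning

∈⇒≤sum : ∀ {n ns} → n ∈ ns → n ≤ sum ns
∈⇒≤sum {ns = n ∷ ns} (here refl) = m≤m+n n (sum ns)
∈⇒≤sum {ns = m ∷ ns} (there n∈ns) = ≤-trans (∈⇒≤sum n∈ns) (m≤n+m (sum ns) m)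

sum-map-mono : {f g : A → ℕ} (xs : List A) → (∀ {x} → x ∈ xs → f x ≤ g x) → sum (map f xs) ≤ sum (map g xs)
sum-map-mono [] _ = z≤n
sum-map-mono (x ∷ xs) f≤g = +-mono-≤ (f≤g (here refl)) (sum-map-mono xs (f≤g ∘ there))

sum-map-zero : (xs : List A) → sum (map (λ _ → 0) xs) ≡ 0
sum-map-zero [] = refl
sum-map-zero (_ ∷ xs) = sum-map-zero xs

sum-map-+ : (f g : A → ℕ) (xs : List A) → sum (map (λ x → f x + g x) xs) ≡ sum (map f xs) + sum (map g xs)
sum-map-+ f g [] = refl
sum-map-+ f g (x ∷ xs) = trans (cong (f x + g x +_) (sum-map-+ f g xs)) (interchange (f x) (g x) _ _)

sum-map-swap : (f : A → B → ℕ) (xs : List A) (ys : List B) →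
  sum (map (λ x → sum (map (f x) ys)) xs) ≡ sum (map (λ y → sum (map (λ x → f x y) xs)) ys)
sum-map-swap f [] ys = sym (sum-map-zero ys)
sum-map-swap f (x ∷ xs) ys =
  trans (cong (sum (map (f x) ys) +_) (sum-map-swap f xs ys))
        (sym (sum-map-+ (f x) (λ y → sum (map (λ x → f x y) xs)) ys))

indicator : Bool → ℕ
indicator true = 1
indicator false = 0

indicator≤ : ∀ {b n} → (T b → 1 ≤ n) → indicator b ≤ n
indicator≤ {true} 1≤n = 1≤n _
indicator≤ {false} _ = z≤n

T⇒indicator≡1 : ∀ {b} → T b → indicator b ≡ 1
T⇒indicator≡1 {true} _ = refl

¬T⇒indicator≡0 : ∀ {b} → ¬ T b → indicator b ≡ 0
¬T⇒indicator≡0 {true} ¬b = contradiction _ ¬b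
¬T⇒indicator≡0 {false} _ = refl

-- In this form count unfolds to the counts nGapsets and countF of Defs.
count : (A → Bool) → List A → ℕ
count p xs = length (filter (λ x → T? (p x)) xs)

count-∷ : (p : A → Bool) (x : A) (xs : List A) → count p (x ∷ xs) ≡ indicator (p x) + count p xs
count-∷ p x xs with p x
... | true = refl
... | false = refl

count≡sum-indicator : (p : A → Bool) (xs : List A) → count p xs ≡ sum (map (indicator ∘ p) xs)
count≡sum-indicator p [] = refl
count≡sum-indicator p (x ∷ xs) = trans (count-∷ p x xs) (cong (indicator (p x) +_) (count≡sum-indicator p xs))

count-cover : {A I J : Set} (p q : A → Bool) (js : List J) (is : J → List I) (r : J → I → A → Bool) (xs : List A) →
  (∀ {x} → x ∈ xs → T (p x) → T (q x) ⊎ ∃ λ j → j ∈ js × ∃ λ i → i ∈ is j × T (r j i x)) →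
  count p xs ≤ count q xs + sum (map (λ j → sum (map (λ i → count (r j i) xs) (is j))) js)
count-cover {A} {I} {J} p q js is r xs cover = begin
  count p xs                                        ≡⟨ count≡sum-indicator p xs ⟩
  sum (map (indicator ∘ p) xs)                      ≤⟨ sum-map-mono xs pointwise ⟩
  sum (map (λ x → indicator (q x) + hits x) xs)     ≡⟨ sum-map-+ (indicator ∘ q) hits xs ⟩
  sum (map (indicator ∘ q) xs) + sum (map hits xs)  ≡⟨ cong₂ _+_ (sym (count≡sum-indicator q xs)) swap ⟩
  count q xs + sum (map (λ j → sum (map (λ i → count (r j i) xs) (is j))) js) ∎
  where
  open ≤-Reasoning
  hit : J → I → A → ℕ
  hit j i x = indicator (r j i x)
  hits : A → ℕ
  hits x = sum (map (λ j → sum (map (λ i → hit j i x) (is j))) js)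
  pointwise : ∀ {x} → x ∈ xs → indicator (p x) ≤ indicator (q x) + hits x
  pointwise {x} x∈xs = indicator≤ λ px → case cover x∈xs px of λ where
    (inj₁ qx) → ≤-trans (≤-reflexive (sym (T⇒indicator≡1 qx))) (m≤m+n _ (hits x))
    (inj₂ (j , j∈js , i , i∈is , rx)) → ≤-trans (≤-reflexive (sym (T⇒indicator≡1 rx)))
      (≤-trans (∈⇒≤sum (∈-map⁺ (λ i → hit j i x) i∈is))
      (≤-trans (∈⇒≤sum (∈-map⁺ (λ j → sum (map (λ i → hit j i x) (is j))) j∈js)) (m≤n+m (hits x) _)))
  swap : sum (map hits xs) ≡ sum (map (λ j → sum (map (λ i → count (r j i) xs) (is j))) js)
  swap = trans (sum-map-swap (λ x j → sum (map (λ i → hit j i x) (is j))) xs js)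
    (cong sum (map-cong (λ j → trans (sum-map-swap (λ x i → hit j i x) xs (is j))
      (cong sum (map-cong (λ i → sym (count≡sum-indicator (r j i) xs)) (is j)))) js))

sum-indicator-≡ᵇ : ∀ {a ks} → Unique ks → a ∈ ks → sum (map (λ k → indicator (a ≡ᵇ k)) ks) ≡ 1
sum-indicator-≡ᵇ {a} {k ∷ ks} (k∉ks ∷ _) (here refl) =
  cong₂ _+_ (T⇒indicator≡1 (≡⇒≡ᵇ a a refl)) (missing k∉ks)
  where
  missing : ∀ {ks} → All (a ≢_) ks → sum (map (λ k → indicator (a ≡ᵇ k)) ks) ≡ 0
  missing [] = refl
  missing {k ∷ _} (a≢k ∷ a∉ks) = cong₂ _+_ (¬T⇒indicator≡0 (a≢k ∘ ≡ᵇ⇒≡ a k)) (missing a∉ks)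
sum-indicator-≡ᵇ {a} {k ∷ ks} (k∉ks ∷ u) (there a∈ks) =
  cong₂ _+_ (¬T⇒indicator≡0 (λ t → All.lookup k∉ks a∈ks (sym (≡ᵇ⇒≡ a k t)))) (sum-indicator-≡ᵇ u a∈ks)

count-partition : (key : A → ℕ) {ks : List ℕ} → Unique ks → (xs : List A) → (∀ {x} → x ∈ xs → key x ∈ ks) →
  sum (map (λ k → count (λ x → key x ≡ᵇ k) xs) ks) ≡ length xs
count-partition key {ks} u [] _ = sum-map-zero ks
count-partition key {ks} u (x ∷ xs) keys∈ = begin
  sum (map (λ k → count (λ x → key x ≡ᵇ k) (x ∷ xs)) ks)
    ≡⟨ cong sum (map-cong (λ k → count-∷ (λ x → key x ≡ᵇ k) x xs) ks) ⟩
  sum (map (λ k → indicator (key x ≡ᵇ k) + count (λ x → key x ≡ᵇ k) xs) ks)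
    ≡⟨ sum-map-+ (λ k → indicator (key x ≡ᵇ k)) (λ k → count (λ x → key x ≡ᵇ k) xs) ks ⟩
  sum (map (λ k → indicator (key x ≡ᵇ k)) ks) + sum (map (λ k → count (λ x → key x ≡ᵇ k) xs) ks)
    ≡⟨ cong₂ _+_ (sum-indicator-≡ᵇ u (keys∈ (here refl))) (count-partition key u xs (keys∈ ∘ there)) ⟩
  suc (length xs) ∎
  where open ≡-Reasoning

⌊n/2⌋+⌊n/2⌋≤n : ∀ n → ⌊ n /2⌋ + ⌊ n /2⌋ ≤ n
⌊n/2⌋+⌊n/2⌋≤n n =
  subst (⌊ n /2⌋ + ⌊ n /2⌋ ≤_) (⌊n/2⌋+⌈n/2⌉≡n n) (+-monoʳ-≤ ⌊ n /2⌋ (⌊n/2⌋≤⌈n/2⌉ n))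

n<2*[1+⌊n/2⌋] : ∀ n → n < 2 * suc ⌊ n /2⌋
n<2*[1+⌊n/2⌋] n = begin-strict
  n                        ≡⟨ sym (⌊n/2⌋+⌈n/2⌉≡n n) ⟩
  ⌊ n /2⌋ + ⌈ n /2⌉         ≤⟨ +-monoʳ-≤ ⌊ n /2⌋ (⌊n/2⌋-mono (n≤1+n (suc n))) ⟩
  ⌊ n /2⌋ + suc ⌊ n /2⌋     <⟨ n<1+n _ ⟩
  suc ⌊ n /2⌋ + suc ⌊ n /2⌋ ≡⟨ cong (suc ⌊ n /2⌋ +_) (sym (+-identityʳ _)) ⟩
  2 * suc ⌊ n /2⌋           ∎
  where open ≤-Reasoning

module _ {m′ : ℕ} where
  private
    m = suc m′

  [r+jm]%m≡r : ∀ {r} j → r ≤ m′ → (r + j * m) % m ≡ r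
  [r+jm]%m≡r {r} j r≤m′ = trans ([m+kn]%n≡m%n r j m) (m≤n⇒m%n≡m r≤m′)

  [r+jm]/m≡j : ∀ {r} j → r ≤ m′ → (r + j * m) / m ≡ j
  [r+jm]/m≡j {r} j r≤m′ = *-cancelʳ-≡ _ j m (+-cancelˡ-≡ r _ _ (begin
    r + (w / m) * m      ≡⟨ cong (_+ (w / m) * m) ([r+jm]%m≡r j r≤m′) ⟨
    w % m + (w / m) * m  ≡⟨ m≡m%n+[m/n]*n w m ⟨
    r + j * m            ∎))
    where
    open ≡-Reasoning
    w = r + j * m

  %-/-injective : ∀ {y z} → y % m ≡ z % m → y / m ≡ z / m → y ≡ z
  %-/-injective {y} {z} %≡ /≡ = begin
    y                    ≡⟨ m≡m%n+[m/n]*n y m ⟩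
    y % m + (y / m) * m  ≡⟨ cong₂ (λ r q → r + q * m) %≡ /≡ ⟩
    z % m + (z / m) * m  ≡⟨ m≡m%n+[m/n]*n z m ⟨
    z                    ∎
    where open ≡-Reasoning

ceilDiv≤⇒≤* : ∀ {a k} m′ → ceilDiv a (suc m′) ≤ k → a ≤ k * suc m′
ceilDiv≤⇒≤* {a} {k} m′ ⌈a/m⌉≤k = ≤-trans (+-cancelʳ-≤ m′ a _ a+m′≤) (*-monoˡ-≤ (suc m′) ⌈a/m⌉≤k)
  where
  q = (a + m′) / suc m′
  a+m′≤ : a + m′ ≤ q * suc m′ + m′
  a+m′≤ = begin
    a + m′                          ≡⟨ m≡m%n+[m/n]*n (a + m′) (suc m′) ⟩
    (a + m′) % suc m′ + q * suc m′  ≤⟨ +-monoˡ-≤ (q * suc m′) (s≤s⁻¹ (m%n<n (a + m′) (suc m′))) ⟩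
    m′ + q * suc m′                 ≡⟨ +-comm m′ (q * suc m′) ⟩
    q * suc m′ + m′                 ∎
    where open ≤-Reasoning

≤*⇒ceilDiv≤ : ∀ {a k} m′ → a ≤ k * suc m′ → ceilDiv a (suc m′) ≤ k
≤*⇒ceilDiv≤ {a} {k} m′ a≤km = s≤s⁻¹ (m<n*o⇒m/o<n (begin-strict
  a + m′          <⟨ +-monoʳ-< a (n<1+n m′) ⟩
  a + suc m′      ≤⟨ +-monoˡ-≤ (suc m′) a≤km ⟩
  k * suc m′ + suc m′ ≡⟨ +-comm (k * suc m′) (suc m′) ⟩
  suc k * suc m′  ∎))
  where open ≤-Reasoning

ceilDiv-monoˡ-≤ : ∀ {a b} m → a ≤ b → ceilDiv a m ≤ ceilDiv b m
ceilDiv-monoˡ-≤ zero _ = z≤n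
ceilDiv-monoˡ-≤ (suc m′) a≤b = /-monoˡ-≤ (suc m′) (+-monoˡ-≤ m′ a≤b)

∧-intro : ∀ {a b} → T a → T b → T (a ∧ b)
∧-intro a b = Equivalence.from T-∧ (a , b)

∈ᵇ⇒∈ : ∀ {x G} → T (x ∈ᵇ G) → x ∈ G
∈ᵇ⇒∈ {x} {G} t = Any.map (λ {y} y≡ᵇx → sym (≡ᵇ⇒≡ y x y≡ᵇx)) (any⁻ (λ y → y ≡ᵇ x) G t)

∈⇒∈ᵇ : ∀ {x G} → x ∈ G → T (x ∈ᵇ G)
∈⇒∈ᵇ {x} x∈G = any⁺ (λ y → y ≡ᵇ x) (Any.map (λ {y} x≡y → ≡⇒≡ᵇ y x (sym x≡y)) x∈G)

∈-range⁺ : ∀ {a b x} → a ≤ x → x ≤ b → x ∈ range a b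
∈-range⁺ {a} {b} {x} a≤x x≤b = subst (_∈ range a b) (m+[n∸m]≡n a≤x)
  (∈-map⁺ (a +_) (∈-upTo⁺ (subst (x ∸ a <_) (sym (+-∸-assoc 1 (≤-trans a≤x x≤b))) (s≤s (∸-monoˡ-≤ a x≤b)))))

∈-range⁻ : ∀ {a b x} → x ∈ range a b → a ≤ x × x ≤ b
∈-range⁻ {a} {b} x∈ with i , i∈ , refl ← ∈-map⁻ (a +_) x∈ = m≤m+n a i , a+i≤b (∈-upTo⁻ i∈)
  where
  a+i≤b : ∀ {i} → i < suc b ∸ a → a + i ≤ b
  a+i≤b {i} i< with a ≤? suc b
  ... | yes a≤1+b = s≤s⁻¹ (subst (_≤ suc b) (trans (+-comm (suc i) a) (+-suc a i)) (m≤o∸n⇒m+n≤o (suc i) a≤1+b i<))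
  ... | no a≰1+b = contradiction (subst (i <_) (m≤n⇒m∸n≡0 (<⇒≤ (≰⇒> a≰1+b))) i<) n≮0

range-unique : ∀ a b → Unique (range a b)
range-unique a b = Unique.map⁺ (+-cancelˡ-≡ a _ _) (Unique.upTo⁺ _)

length-range : ∀ a b → length (range a b) ≡ suc b ∸ a
length-range a b = trans (length-map (a +_) (upTo (suc b ∸ a))) (length-upTo _)

∈-sublists-∷⁻ : ∀ {x xs G} → G ∈ sublists (x ∷ xs) →
  G ∈ sublists xs ⊎ ∃ λ G′ → G′ ∈ sublists xs × G ≡ x ∷ G′
∈-sublists-∷⁻ {x} {xs} G∈ with ∈-++⁻ (sublists xs) G∈
... | inj₁ G∈xs = inj₁ G∈xs
... | inj₂ G∈x∷xs with G′ , G′∈ , refl ← ∈-map⁻ (x ∷_) G∈x∷xs = inj₂ (G′ , G′∈ , refl)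

sublists⊆ : ∀ {xs G} → G ∈ sublists xs → G ⊆ xs
sublists⊆ {[]} (here refl) ()
sublists⊆ {x ∷ xs} G∈ z∈G with ∈-sublists-∷⁻ {x} {xs} G∈
... | inj₁ G∈xs = there (sublists⊆ G∈xs z∈G)
... | inj₂ (G′ , G′∈ , refl) with z∈G
...   | here refl = here refl
...   | there z∈G′ = there (sublists⊆ G′∈ z∈G′)

sublists-Unique : ∀ {xs G} → Unique xs → G ∈ sublists xs → Unique G
sublists-Unique {[]} _ (here refl) = []
sublists-Unique {x ∷ xs} (x∉xs ∷ u) G∈ with ∈-sublists-∷⁻ {x} {xs} G∈
... | inj₁ G∈xs = sublists-Unique u G∈xs
... | inj₂ (G′ , G′∈ , refl) = anti-mono (sublists⊆ G′∈) x∉xs ∷ sublists-Unique u G′∈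

Unique-sublists : ∀ {xs} → Unique xs → Unique (sublists xs)
Unique-sublists {[]} _ = [] ∷ []
Unique-sublists {x ∷ xs} (x∉xs ∷ u) =
  Unique.++⁺ (Unique-sublists u) (Unique.map⁺ ∷-injectiveʳ (Unique-sublists u)) disjoint
  where
  disjoint : ∀ {G} → G ∈ sublists xs × G ∈ map (x ∷_) (sublists xs) → ⊥
  disjoint (G∈ , G∈x∷xs) with G′ , _ , refl ← ∈-map⁻ (x ∷_) G∈x∷xs =
    All.lookup x∉xs (sublists⊆ G∈ (here refl)) refl

sublists-⊆-antisym : ∀ {xs G H} → Unique xs → G ∈ sublists xs → H ∈ sublists xs → G ⊆ H → H ⊆ G → G ≡ H
sublists-⊆-antisym {[]} _ (here refl) (here refl) _ _ = refl
sublists-⊆-antisym {x ∷ xs} (x∉xs ∷ u) G∈ H∈ G⊆H H⊆G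
  with ∈-sublists-∷⁻ {x} {xs} G∈ | ∈-sublists-∷⁻ {x} {xs} H∈
... | inj₁ G∈xs | inj₁ H∈xs = sublists-⊆-antisym u G∈xs H∈xs G⊆H H⊆G
... | inj₁ G∈xs | inj₂ (_ , _ , refl) = ⊥-elim (All.lookup x∉xs (sublists⊆ G∈xs (H⊆G (here refl))) refl)
... | inj₂ (_ , _ , refl) | inj₁ H∈xs = ⊥-elim (All.lookup x∉xs (sublists⊆ H∈xs (G⊆H (here refl))) refl)
... | inj₂ (G′ , G′∈ , refl) | inj₂ (H′ , H′∈ , refl) =
  cong (x ∷_) (sublists-⊆-antisym u G′∈ H′∈ (drop-x G′∈ (G⊆H ∘ there)) (drop-x H′∈ (H⊆G ∘ there)))
  where
  drop-x : ∀ {K L} → K ∈ sublists xs → K ⊆ x ∷ L → K ⊆ L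
  drop-x K∈ K⊆x∷L z∈K with K⊆x∷L z∈K
  ... | here refl = ⊥-elim (All.lookup x∉xs (sublists⊆ K∈ z∈K) refl)
  ... | there z∈L = z∈L

leastFrom-≥ : ∀ p s fuel → s ≤ leastFrom p s fuel
leastFrom-≥ p s zero = ≤-refl
leastFrom-≥ p s (suc fuel) with p s
... | true = ≤-refl
... | false = ≤-trans (n≤1+n s) (leastFrom-≥ p (suc s) fuel)

leastFrom-minimal : ∀ p s fuel {t} → s ≤ t → t < leastFrom p s fuel → ¬ T (p t)
leastFrom-minimal p s zero s≤t t< = contradiction s≤t (<⇒≱ t<)
leastFrom-minimal p s (suc fuel) {t} s≤t t< with p s in ps
... | true = contradiction s≤t (<⇒≱ t<)
... | false with m≤n⇒m<n∨m≡n s≤t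
...   | inj₁ s<t = leastFrom-minimal p (suc s) fuel s<t t<
...   | inj₂ refl = subst T ps

leastFrom-found : ∀ p s fuel → leastFrom p s fuel ≡ s + fuel ⊎ T (p (leastFrom p s fuel))
leastFrom-found p s zero = inj₁ (sym (+-identityʳ s))
leastFrom-found p s (suc fuel) with p s in ps
... | true = inj₂ (subst T (sym ps) _)
... | false with leastFrom-found p (suc s) fuel
...   | inj₁ exhausted = inj₁ (trans exhausted (sym (+-suc s fuel)))
...   | inj₂ found = inj₂ found

1≤multiplicity : ∀ G → 1 ≤ multiplicity G
1≤multiplicity G = leastFrom-≥ _ 1 (suc (length G))

<multiplicity⇒∈ : ∀ G {s} → 1 ≤ s → s < multiplicity G → s ∈ G
<multiplicity⇒∈ G {s} 1≤s s<m with s ∈ᵇ G in s∈ᵇG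
... | true = ∈ᵇ⇒∈ (subst T (sym s∈ᵇG) _)
... | false = contradiction (subst (T ∘ not) (sym s∈ᵇG) _) (leastFrom-minimal _ 1 (suc (length G)) 1≤s s<m)

multiplicity∉ : ∀ {G} → Unique G → multiplicity G ∉ G
multiplicity∉ {G} u m∈G with leastFrom-found (λ s → not (s ∈ᵇ G)) 1 (suc (length G))
... | inj₂ m∉ᵇG with () ← trans (sym (Equivalence.to T-not-≡ m∉ᵇG)) (Equivalence.to T-≡ (∈⇒∈ᵇ m∈G))
... | inj₁ exhausted =
  1+n≰n (subst (_≤ length G) (length-range 1 (suc (length G))) (Unique⇒length≤ (range-unique 1 _) prefix⊆G))
  where
  prefix⊆G : range 1 (suc (length G)) ⊆ G
  prefix⊆G s∈ with 1≤s , s≤ ← ∈-range⁻ s∈ = <multiplicity⇒∈ G 1≤s (subst (_ <_) (sym exhausted) (s≤s s≤))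

∈⇒<conductor : ∀ G {z} → z ∈ G → z < conductor G
∈⇒<conductor G {z} z∈G with leastFrom-found (λ s → all (_<ᵇ s) G) 0 (suc (sum G))
... | inj₁ exhausted = subst (z <_) (sym exhausted) (s≤s (∈⇒≤sum z∈G))
... | inj₂ bounded = <ᵇ⇒< z _ (All.lookup (all⁺ _ G bounded) z∈G)

conductor≡1+max : ∀ G {z} → z ∈ G → ∃ λ d → conductor G ≡ suc d × d ∈ G
conductor≡1+max G z∈G with conductor G in c≡ | ∈⇒<conductor G z∈G
... | suc d | _ = d , refl , d∈G
  where
  not-bounded : ¬ T (all (_<ᵇ d) G)
  not-bounded = leastFrom-minimal _ 0 (suc (sum G)) z≤n (subst (d <_) (sym c≡) ≤-refl)
  d∈G : d ∈ G
  d∈G with y , y∈G , y≮ᵇd ← find (¬All⇒Any¬ (λ y → T? (y <ᵇ d)) G (not-bounded ∘ all⁻ _)) =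
    subst (_∈ G) (≤-antisym (s≤s⁻¹ (subst (y <_) c≡ (∈⇒<conductor G y∈G))) (≮⇒≥ (y≮ᵇd ∘ <⇒<ᵇ))) y∈G

-- Gapsets and the conductor bound

record IsGapset (G : List ℕ) : Set where
  field
    unique   : Unique G
    positive : ∀ {z} → z ∈ G → 1 ≤ z
    split    : ∀ {z x} → z ∈ G → 1 ≤ x → x < z → x ∈ G ⊎ z ∸ x ∈ G

isGapset⇒IsGapset : ∀ B {G} → G ∈ subsetsUpTo B → T (isGapset G) → IsGapset G
isGapset⇒IsGapset B {G} G∈ isG = record
  { unique   = sublists-Unique (range-unique 1 B) G∈
  ; positive = λ z∈G → proj₁ (∈-range⁻ {1} {B} (sublists⊆ {range 1 B} G∈ z∈G))
  ; split    = split
  }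
  where
  split : ∀ {z x} → z ∈ G → 1 ≤ x → x < z → x ∈ G ⊎ z ∸ x ∈ G
  split {z} {x} z∈G 1≤x x<z
    with Equivalence.to T-∨ (All.lookup (all⁺ _ _ (All.lookup (all⁺ _ G isG) z∈G)) (∈-range⁺ 1≤x (∸-monoˡ-≤ 1 x<z)))
  ... | inj₁ x∈ᵇG = inj₁ (∈ᵇ⇒∈ x∈ᵇG)
  ... | inj₂ z∸x∈ᵇG = inj₂ (∈ᵇ⇒∈ z∸x∈ᵇG)

-- For a gap d, each x ≤ ⌊d/2⌋ yields a gap x or d − x; these gaps are distinct
-- from each other and from d, so #G ≥ 1 + ⌊d/2⌋.
module _ {G : List ℕ} (gapset : IsGapset G) {d : ℕ} (d∈G : d ∈ G) where
  open IsGapset gapset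

  private
    lower : List ℕ
    lower = range 1 ⌊ d /2⌋

    x+x≤d : ∀ {x} → x ∈ lower → x + x ≤ d
    x+x≤d {x} x∈ = ≤-trans (+-mono-≤ x≤ x≤) (⌊n/2⌋+⌊n/2⌋≤n d) where x≤ = proj₂ (∈-range⁻ x∈)

    x<d : ∀ {x} → x ∈ lower → x < d
    x<d {x} x∈ = ≤-trans (subst (_≤ x + x) (+-comm x 1) (+-monoʳ-≤ x (proj₁ (∈-range⁻ x∈)))) (x+x≤d x∈)

    partner : ℕ → ℕ
    partner x with x ∈? G
    ... | yes _ = x
    ... | no _ = d ∸ x

    partner∈G : ∀ {x} → x ∈ lower → partner x ∈ G
    partner∈G {x} x∈ with x ∈? G
    ... | yes x∈G = x∈G
    ... | no x∉G with split d∈G (proj₁ (∈-range⁻ x∈)) (x<d x∈)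
    ...   | inj₁ x∈G = contradiction x∈G x∉G
    ...   | inj₂ d∸x∈G = d∸x∈G

    partner<d : ∀ {x} → x ∈ lower → partner x < d
    partner<d {x} x∈ with x ∈? G
    ... | yes _ = x<d x∈
    ... | no _ = ∸-monoʳ-< (proj₁ (∈-range⁻ x∈)) (<⇒≤ (x<d x∈))

    complementary⇒≡ : ∀ {x y} → x ∈ lower → y ∈ lower → x ≡ d ∸ y → x ≡ y
    complementary⇒≡ {x} {y} x∈ y∈ x≡d∸y = ≤-antisym
      (+-cancelˡ-≤ x x y (subst (x + x ≤_) (sym x+y≡d) (x+x≤d x∈)))
      (+-cancelˡ-≤ y y x (subst (y + y ≤_) (trans (sym x+y≡d) (+-comm x y)) (x+x≤d y∈)))
      where
      x+y≡d : x + y ≡ d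
      x+y≡d = trans (cong (_+ y) x≡d∸y) (m∸n+n≡m (<⇒≤ (x<d y∈)))

    partner-injective : InjectiveOn partner lower
    partner-injective {x} {y} x∈ y∈ eq with x ∈? G | y ∈? G
    ... | yes _ | yes _ = eq
    ... | no _ | no _ = ∸-cancelˡ-≡ (<⇒≤ (x<d x∈)) (<⇒≤ (x<d y∈)) eq
    ... | yes x∈G | no y∉G = contradiction (subst (_∈ G) (complementary⇒≡ x∈ y∈ eq) x∈G) y∉G
    ... | no x∉G | yes y∈G = contradiction (subst (_∈ G) (complementary⇒≡ y∈ x∈ (sym eq)) y∈G) x∉G

  1+gap≤2*genus : suc d ≤ 2 * length G
  1+gap≤2*genus = ≤-trans (n<2*[1+⌊n/2⌋] d) (*-monoʳ-≤ 2 (begin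
    suc ⌊ d /2⌋                    ≡⟨ cong suc (sym (trans (length-map partner lower) (length-range 1 ⌊ d /2⌋))) ⟩
    length (d ∷ map partner lower)  ≤⟨ Unique⇒length≤ witnesses-unique witnesses⊆G ⟩
    length G                       ∎))
    where
    open ≤-Reasoning
    witnesses-unique : Unique (d ∷ map partner lower)
    witnesses-unique = All.tabulate d∉ ∷ Unique-map⁺ partner partner-injective (range-unique 1 ⌊ d /2⌋)
      where
      d∉ : ∀ {w} → w ∈ map partner lower → d ≢ w
      d∉ w∈ refl with x , x∈ , eq ← ∈-map⁻ partner w∈ = <⇒≢ (partner<d x∈) (sym eq)
    witnesses⊆G : d ∷ map partner lower ⊆ G
    witnesses⊆G (here refl) = d∈G
    witnesses⊆G (there w∈) with x , x∈ , refl ← ∈-map⁻ partner w∈ = partner∈G x∈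

conductor≤2*genus : ∀ {G} → IsGapset G → conductor G ≤ 2 * length G
conductor≤2*genus {[]} _ = z≤n
conductor≤2*genus {z ∷ G} gapset with d , c≡ , d∈ ← conductor≡1+max (z ∷ G) (here refl) =
  subst (_≤ 2 * length (z ∷ G)) (sym c≡) (1+gap≤2*genus gapset d∈)

-- Compositions and generalized Fibonacci numbers

fibSeq≡ : ∀ k n → fibSeq k n ≡ map (λ j → F k (n ∸ j)) (upTo n)
fibSeq≡ k zero = refl
fibSeq≡ k (suc n) = trans (fibSeq-∷ n) (cong (F k (suc n) ∷_) (begin
  fibSeq k n                                     ≡⟨ fibSeq≡ k n ⟩
  map (λ j → F k (n ∸ j)) (upTo n)               ≡⟨ map-∘ (upTo n) ⟩
  map (λ j → F k (suc n ∸ j)) (map suc (upTo n)) ≡⟨ cong (map (λ j → F k (suc n ∸ j))) (map-upTo suc n) ⟩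
  map (λ j → F k (suc n ∸ j)) (applyUpTo suc n)   ∎))
  where
  open ≡-Reasoning
  fibSeq-∷ : ∀ n → fibSeq k (suc n) ≡ F k (suc n) ∷ fibSeq k n
  fibSeq-∷ zero = refl
  fibSeq-∷ (suc n) = refl

F-recurrence : ∀ k n → F k (suc (suc n)) ≡ sum (map (λ j → F k (suc n ∸ j)) (upTo (k ⊓ suc n)))
F-recurrence k n = begin
  sum (take k (fibSeq k (suc n)))                                 ≡⟨ cong (sum ∘ take k) (fibSeq≡ k (suc n)) ⟩
  sum (take k (map (λ j → F k (suc n ∸ j)) (upTo (suc n))))      ≡⟨ cong sum (take-map k (upTo (suc n))) ⟩
  sum (map (λ j → F k (suc n ∸ j)) (take k (upTo (suc n))))      ≡⟨ cong (sum ∘ map _) (take-upTo k (suc n)) ⟩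
  sum (map (λ j → F k (suc n ∸ j)) (upTo (k ⊓ suc n)))           ∎
  where open ≡-Reasoning

IsComposition : ℕ → ℕ → List ℕ → Set
IsComposition k g t = All (λ x → 1 ≤ x × x ≤ k) t × sum t ≡ g

IsComposition-∷⁻ : ∀ {k g j t} → IsComposition k (suc g) (suc j ∷ t) → IsComposition k (g ∸ j) t
IsComposition-∷⁻ {g = g} {j} {t} (_ ∷ parts , Σ≡) = parts , (begin
  sum t            ≡⟨ m+n∸m≡n j (sum t) ⟨
  j + sum t ∸ j    ≡⟨ cong (_∸ j) (suc-injective Σ≡) ⟩
  g ∸ j            ∎)
  where open ≡-Reasoning

firstPart : List ℕ → ℕ
firstPart [] = 0
firstPart (x ∷ _) = pred x

withFirstPart-tails : ∀ {k g} j {L : List (List ℕ)} → Unique L → All (IsComposition k (suc g)) L →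
  ∃ λ L′ → Unique L′ × All (IsComposition k (g ∸ j)) L′ × length L′ ≡ count (λ t → firstPart t ≡ᵇ j) L
withFirstPart-tails {k} {g} j {L} u comps =
  map tail Lⱼ , Unique-map⁺ tail tail-injective (Unique.filter⁺ _ u) , tails-compose , length-map tail Lⱼ
  where
  Lⱼ = filter (λ t → T? (firstPart t ≡ᵇ j)) L
  tail : List ℕ → List ℕ
  tail [] = []
  tail (_ ∷ t) = t
  ∈Lⱼ⇒ : ∀ {t} → t ∈ Lⱼ → t ∈ L × t ≡ suc j ∷ tail t
  ∈Lⱼ⇒ {t} t∈ with t∈L , firstPart≡ᵇj ← ∈-filter⁻ (λ t → T? (firstPart t ≡ᵇ j)) {xs = L} t∈ =
    t∈L , shape t (All.lookup comps t∈L) firstPart≡ᵇj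
    where
    shape : ∀ t → IsComposition k (suc g) t → T (firstPart t ≡ᵇ j) → t ≡ suc j ∷ tail t
    shape [] (_ , ())
    shape (zero ∷ _) ((() , _) ∷ _ , _) _
    shape (suc x ∷ t) _ firstPart≡ᵇj = cong (λ y → suc y ∷ t) (≡ᵇ⇒≡ x j firstPart≡ᵇj)
  tail-injective : InjectiveOn tail Lⱼ
  tail-injective s∈ t∈ tails≡ =
    trans (proj₂ (∈Lⱼ⇒ s∈)) (trans (cong (suc j ∷_) tails≡) (sym (proj₂ (∈Lⱼ⇒ t∈))))
  tails-compose : All (IsComposition k (g ∸ j)) (map tail Lⱼ)
  tails-compose = All.tabulate λ r∈ → case ∈-map⁻ tail r∈ of λ where
    (t , t∈ , refl) → let t∈L , t≡ = ∈Lⱼ⇒ t∈ in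
      IsComposition-∷⁻ (subst (IsComposition k (suc g)) t≡ (All.lookup comps t∈L))

compositions≤F : ∀ k g {L : List (List ℕ)} → Unique L → All (IsComposition k g) L → length L ≤ F k (suc g)
compositions≤F k g = go g (<-wellFounded g)
  where
  go : ∀ g → Acc _<_ g → {L : List (List ℕ)} → Unique L → All (IsComposition k g) L → length L ≤ F k (suc g)
  go zero _ u comps = Unique⇒length≤ {ys = [] ∷ []} u (λ t∈ → here (empty (All.lookup comps t∈)))
    where
    empty : ∀ {t} → IsComposition k 0 t → t ≡ []
    empty {[]} _ = refl
    empty {x ∷ t} ((1≤x , _) ∷ _ , Σt≡0) = contradiction (subst (1 ≤_) Σt≡0 (≤-trans 1≤x (m≤m+n x (sum t)))) λ ()
  go (suc g) (acc smaller) {L} u comps = begin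
    length L                                                ≡⟨ count-partition firstPart (Unique.upTo⁺ _) L firstPart∈J ⟨
    sum (map (λ j → count (λ t → firstPart t ≡ᵇ j) L) J)    ≤⟨ sum-map-mono J withFirstPart≤ ⟩
    sum (map (λ j → F k (suc g ∸ j)) J)                     ≡⟨ F-recurrence k g ⟨
    F k (suc (suc g))                                       ∎
    where
    open ≤-Reasoning
    J = upTo (k ⊓ suc g)
    firstPart∈J : ∀ {t} → t ∈ L → firstPart t ∈ J
    firstPart∈J {t} t∈L with All.lookup comps t∈L
    firstPart∈J {[]} _ | _ , ()
    firstPart∈J {suc x ∷ t} _ | (_ , 1+x≤k) ∷ _ , Σ≡ =
      ∈-upTo⁺ (⊓-pres-m< 1+x≤k (≤-trans (m≤m+n (suc x) (sum t)) (≤-reflexive Σ≡)))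
    withFirstPart≤ : ∀ {j} → j ∈ J → count (λ t → firstPart t ≡ᵇ j) L ≤ F k (suc g ∸ j)
    withFirstPart≤ {j} j∈J with L′ , u′ , comps′ , length≡ ← withFirstPart-tails j u comps =
      subst₂ _≤_ length≡ (cong (F k) (sym (+-∸-assoc 1 j≤g))) (go (g ∸ j) (smaller (s≤s (m∸n≤m g j))) u′ comps′)
      where
      j≤g : j ≤ g
      j≤g = s≤s⁻¹ (≤-trans (∈-upTo⁻ j∈J) (m⊓n≤n k (suc g)))

-- Kunz coordinates

module _ {Q : List ℕ} (unique : Unique Q) (closed : ∀ {i j} → j ≤ i → i ∈ Q → j ∈ Q) where

  ∈⇒<length : ∀ {j} → j ∈ Q → j < length Q
  ∈⇒<length {j} j∈Q = subst (_≤ length Q) (length-upTo (suc j)) (Unique⇒length≤ (Unique.upTo⁺ (suc j)) below⊆Q)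
    where
    below⊆Q : upTo (suc j) ⊆ Q
    below⊆Q i∈ = closed (s≤s⁻¹ (∈-upTo⁻ i∈)) j∈Q

  <length⇒∈ : ∀ {j} → j < length Q → j ∈ Q
  <length⇒∈ {j} j< with j ∈? Q
  ... | yes j∈Q = j∈Q
  ... | no j∉Q = contradiction (subst (length Q ≤_) (length-upTo j) (Unique⇒length≤ unique Q⊆below)) (<⇒≱ j<)
    where
    Q⊆below : Q ⊆ upTo j
    Q⊆below {i} i∈Q with i <? j
    ... | yes i<j = ∈-upTo⁺ i<j
    ... | no i≮j = contradiction (closed (≮⇒≥ i≮j) i∈Q) j∉Q

-- The modulus is passed as m′ = m − 1, so that it is visibly nonzero.
kunz : ℕ → List ℕ → ℕ → ℕ
kunz m′ G r = count (λ z → z % suc m′ ≡ᵇ r) G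

kunzVector : List ℕ → List ℕ
kunzVector G = map (kunz (pred (multiplicity G)) G) (range 1 (pred (multiplicity G)))

1+pred-multiplicity : ∀ G → suc (pred (multiplicity G)) ≡ multiplicity G
1+pred-multiplicity G = suc-pred (multiplicity G) {{>-nonZero (1≤multiplicity G)}}

module Kunz {G : List ℕ} (gapset : IsGapset G) {m′ : ℕ} (m≡multiplicity : suc m′ ≡ multiplicity G) where
  open IsGapset gapset

  private
    m = suc m′

  m∉G : m ∉ G
  m∉G = subst (_∉ G) (sym m≡multiplicity) (multiplicity∉ unique)

  ≤m′⇒∈ : ∀ {s} → 1 ≤ s → s ≤ m′ → s ∈ G
  ≤m′⇒∈ 1≤s s≤m′ = <multiplicity⇒∈ G 1≤s (subst (_ <_) m≡multiplicity (s≤s s≤m′))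

  m+w∈⇒w∈ : ∀ {w} → m + w ∈ G → w ∈ G
  m+w∈⇒w∈ {zero} m+0∈G = contradiction (subst (_∈ G) (+-identityʳ m) m+0∈G) m∉G
  m+w∈⇒w∈ {suc w} m+w∈G with split m+w∈G (s≤s z≤n) (m<m+n m (s≤s z≤n))
  ... | inj₁ m∈G = contradiction m∈G m∉G
  ... | inj₂ m+w∸m∈G = subst (_∈ G) (m+n∸m≡n m (suc w)) m+w∸m∈G

  ∈-downward : ∀ {r i j} → j ≤ i → r + i * m ∈ G → r + j * m ∈ G
  ∈-downward {i = zero} z≤n r∈G = r∈G
  ∈-downward {r} {suc i} {j} j≤1+i r+[1+i]m∈G with j ≟ suc i
  ... | yes refl = r+[1+i]m∈G
  ... | no j≢1+i =
    ∈-downward (s≤s⁻¹ (≤∧≢⇒< j≤1+i j≢1+i)) (m+w∈⇒w∈ (subst (_∈ G) (x∙yz≈y∙xz r m (i * m)) r+[1+i]m∈G))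

  multiple∉ : ∀ j → j * m ∉ G
  multiple∉ j jm∈G = contradiction (positive (∈-downward {0} {j} z≤n jm∈G)) λ ()

  residue∈ : ∀ {z} → z ∈ G → z % m ∈ range 1 m′
  residue∈ {z} z∈G = ∈-range⁺ (n≢0⇒n>0 r≢0) (s≤s⁻¹ (m%n<n z m))
    where
    r≢0 : z % m ≢ 0
    r≢0 r≡0 = multiple∉ (z / m) (subst (_∈ G) (trans (m≡m%n+[m/n]*n z m) (cong (_+ (z / m) * m) r≡0)) z∈G)

  class : ℕ → List ℕ
  class r = filter (λ z → T? (z % m ≡ᵇ r)) G

  quotients : ℕ → List ℕ
  quotients r = map (_/ m) (class r)

  ∈-class⁻ : ∀ {r y} → y ∈ class r → y ∈ G × y % m ≡ r
  ∈-class⁻ {r} y∈ with y∈G , y%m≡ᵇr ← ∈-filter⁻ (λ z → T? (z % m ≡ᵇ r)) {xs = G} y∈ =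
    y∈G , ≡ᵇ⇒≡ _ r y%m≡ᵇr

  ∈-class⁺ : ∀ {y} → y ∈ G → y ∈ class (y % m)
  ∈-class⁺ {y} y∈G = ∈-filter⁺ (λ z → T? (z % m ≡ᵇ y % m)) y∈G (≡⇒≡ᵇ (y % m) (y % m) refl)

  quotients-unique : ∀ r → Unique (quotients r)
  quotients-unique r = Unique-map⁺ (_/ m) same-class (Unique.filter⁺ (λ z → T? (z % m ≡ᵇ r)) unique)
    where
    same-class : InjectiveOn (_/ m) (class r)
    same-class y∈ z∈ = %-/-injective (trans (proj₂ (∈-class⁻ y∈)) (sym (proj₂ (∈-class⁻ z∈))))

  quotients-closed : ∀ {r i j} → j ≤ i → i ∈ quotients r → j ∈ quotients r
  quotients-closed {r} {j = j} j≤i i∈ with y , y∈ , refl ← ∈-map⁻ (_/ m) i∈ with y∈G , refl ← ∈-class⁻ y∈ =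
    subst (_∈ quotients r) ([r+jm]/m≡j j r≤m′)
      (∈-map⁺ (_/ m) (subst (λ s → r + j * m ∈ class s) ([r+jm]%m≡r j r≤m′)
        (∈-class⁺ (∈-downward j≤i (subst (_∈ G) (m≡m%n+[m/n]*n y m) y∈G)))))
    where
    r≤m′ = s≤s⁻¹ (m%n<n y m)

  ∈⇔<kunz : ∀ {z} → z ∈ G ⇔ z / m < kunz m′ G (z % m)
  ∈⇔<kunz {z} = mk⇔ ⇒ ⇐
    where
    length-quotients : length (quotients (z % m)) ≡ kunz m′ G (z % m)
    length-quotients = length-map (_/ m) (class (z % m))
    ⇒ : z ∈ G → z / m < kunz m′ G (z % m)
    ⇒ z∈G = subst (z / m <_) length-quotients
      (∈⇒<length (quotients-unique _) quotients-closed (∈-map⁺ (_/ m) (∈-class⁺ z∈G)))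
    ⇐ : z / m < kunz m′ G (z % m) → z ∈ G
    ⇐ z/m< with y , y∈ , z/m≡y/m ← ∈-map⁻ (_/ m) (<length⇒∈ (quotients-unique _) quotients-closed
                                                                (subst (z / m <_) (sym length-quotients) z/m<))
      with y∈G , y%m≡z%m ← ∈-class⁻ y∈ = subst (_∈ G) (%-/-injective y%m≡z%m (sym z/m≡y/m)) y∈G

  kunz≤ : ∀ {k} → (∀ {z} → z ∈ G → z < k * m) → ∀ r → kunz m′ G r ≤ k
  kunz≤ {k} G<km r = subst₂ _≤_ (length-map (_/ m) (class r)) (length-upTo k)
    (Unique⇒length≤ (quotients-unique r) quotients⊆)
    where
    quotients⊆ : quotients r ⊆ upTo k
    quotients⊆ q∈ with y , y∈ , refl ← ∈-map⁻ (_/ m) q∈ = ∈-upTo⁺ (m<n*o⇒m/o<n (G<km (proj₁ (∈-class⁻ y∈))))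

  1≤kunz : ∀ {r} → 1 ≤ r → r ≤ m′ → 1 ≤ kunz m′ G r
  1≤kunz {r} 1≤r r≤m′ = subst₂ (λ q s → q < kunz m′ G s) (m<n⇒m/n≡0 (s≤s r≤m′)) (m≤n⇒m%n≡m r≤m′)
    (Equivalence.to ∈⇔<kunz (≤m′⇒∈ 1≤r r≤m′))

  sum-kunz : sum (map (kunz m′ G) (range 1 m′)) ≡ length G
  sum-kunz = count-partition (_% m) (range-unique 1 m′) G residue∈

kunzVector-composition : ∀ {G k} → IsGapset G → depth G ≤ k → IsComposition k (length G) (kunzVector G)
kunzVector-composition {G} {k} gapset depth≤k = All.tabulate parts , sum-kunz
  where
  open Kunz gapset (1+pred-multiplicity G)
  m′ = pred (multiplicity G)
  G<km : ∀ {z} → z ∈ G → z < k * suc m′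
  G<km z∈G = <-≤-trans (∈⇒<conductor G z∈G)
    (ceilDiv≤⇒≤* m′ (subst (λ m → ceilDiv (conductor G) m ≤ k) (sym (1+pred-multiplicity G)) depth≤k))
  parts : ∀ {x} → x ∈ kunzVector G → 1 ≤ x × x ≤ k
  parts x∈ with r , r∈ , refl ← ∈-map⁻ (kunz m′ G) x∈ =
    1≤kunz (proj₁ (∈-range⁻ r∈)) (proj₂ (∈-range⁻ r∈)) , kunz≤ G<km r

kunzVector-⊆ : ∀ {G H} → IsGapset G → IsGapset H → kunzVector G ≡ kunzVector H → G ⊆ H
kunzVector-⊆ {G} {H} G-gapset H-gapset same {z} z∈G =
  Equivalence.from KH.∈⇔<kunz
    (subst (z / suc m′ <_) (map≡map⇒≡ same′ (KG.residue∈ z∈G)) (Equivalence.to KG.∈⇔<kunz z∈G))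
  where
  m′ = pred (multiplicity G)
  length-kunzVector : ∀ K → length (kunzVector K) ≡ pred (multiplicity K)
  length-kunzVector K = let n = pred (multiplicity K) in trans (length-map (kunz n K) (range 1 n)) (length-range 1 n)
  m′≡ : m′ ≡ pred (multiplicity H)
  m′≡ = trans (sym (length-kunzVector G)) (trans (cong length same) (length-kunzVector H))
  module KG = Kunz G-gapset (1+pred-multiplicity G)
  module KH = Kunz H-gapset (trans (cong suc m′≡) (1+pred-multiplicity H))
  same′ : map (kunz m′ G) (range 1 m′) ≡ map (kunz m′ H) (range 1 m′)
  same′ = subst (λ n → kunzVector G ≡ map (kunz n H) (range 1 n)) (sym m′≡) same

shallowGapsets≤F : ∀ B g k →
  count (λ G → isGapset G ∧ (genus G ≡ᵇ g) ∧ (depth G ≤ᵇ k)) (subsetsUpTo B) ≤ F k (suc g)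
shallowGapsets≤F B g k = begin
  length L                  ≡⟨ length-map kunzVector L ⟨
  length (map kunzVector L) ≤⟨ compositions≤F k g (Unique-map⁺ kunzVector injective L-unique) compositions ⟩
  F k (suc g)               ∎
  where
  open ≤-Reasoning
  shallow : List ℕ → Bool
  shallow G = isGapset G ∧ (genus G ≡ᵇ g) ∧ (depth G ≤ᵇ k)
  L = filter (λ G → T? (shallow G)) (subsetsUpTo B)
  L-unique : Unique L
  L-unique = Unique.filter⁺ (λ G → T? (shallow G)) (Unique-sublists (range-unique 1 B))
  ∈L⇒ : ∀ {G} → G ∈ L → G ∈ subsetsUpTo B × IsGapset G × length G ≡ g × depth G ≤ k
  ∈L⇒ {G} G∈L with G∈S , shallowG ← ∈-filter⁻ (λ G → T? (shallow G)) {xs = subsetsUpTo B} G∈L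
    with isG , rest ← Equivalence.to T-∧ shallowG with genus≡g , depth≤k ← Equivalence.to T-∧ rest =
    G∈S , isGapset⇒IsGapset B G∈S isG , ≡ᵇ⇒≡ _ g genus≡g , ≤ᵇ⇒≤ _ k depth≤k
  injective : InjectiveOn kunzVector L
  injective G∈L H∈L same with G∈S , G-gapset , _ ← ∈L⇒ G∈L | H∈S , H-gapset , _ ← ∈L⇒ H∈L =
    sublists-⊆-antisym (range-unique 1 B) G∈S H∈S
      (kunzVector-⊆ G-gapset H-gapset same) (kunzVector-⊆ H-gapset G-gapset (sym same))
  compositions : All (IsComposition k g) (map kunzVector L)
  compositions = All.tabulate λ v∈ → case ∈-map⁻ kunzVector v∈ of λ where
    (G , G∈L , refl) → let _ , G-gapset , genus≡g , depth≤k = ∈L⇒ G∈L in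
      subst (λ n → IsComposition k n (kunzVector G)) genus≡g (kunzVector-composition G-gapset depth≤k)

-- Gapsets of large depth

2≤multiplicity : ∀ {G} → IsGapset G → 1 ≤ length G → 2 ≤ multiplicity G
2≤multiplicity {z ∷ G} gapset _ with multiplicity (z ∷ G) in m≡ | 1≤multiplicity (z ∷ G)
... | suc (suc _) | _ = s≤s (s≤s z≤n)
... | suc zero | _ = contradiction (subst (_∈ z ∷ G) (sym (*-identityʳ z)) (here refl)) (Kunz.multiple∉ gapset (sym m≡) z)

depth≤⌈2g/m⌉ : ∀ {G} → IsGapset G → depth G ≤ ceilDiv (2 * length G) (multiplicity G)
depth≤⌈2g/m⌉ {G} gapset = ceilDiv-monoˡ-≤ (multiplicity G) (conductor≤2*genus gapset)

deep⇒multiplicity≤ : ∀ {G} M → IsGapset G → ceilDiv (2 * length G) (suc M) < depth G → multiplicity G ≤ M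
deep⇒multiplicity≤ {G} M gapset k<depth with suc (pred (multiplicity G)) ≤? M
... | yes m≤M = subst (_≤ M) (1+pred-multiplicity G) m≤M
... | no m≰M = contradiction depth≤k (<⇒≱ k<depth)
  where
  open ≤-Reasoning
  k = ceilDiv (2 * length G) (suc M)
  m′ = pred (multiplicity G)
  depth≤k : depth G ≤ k
  depth≤k = subst (λ m → ceilDiv (conductor G) m ≤ k) (1+pred-multiplicity G) (≤*⇒ceilDiv≤ m′ (begin
    conductor G     ≤⟨ conductor≤2*genus gapset ⟩
    2 * length G    ≤⟨ ceilDiv≤⇒≤* M ≤-refl ⟩
    k * suc M       ≤⟨ *-monoʳ-≤ k (≰⇒> m≰M) ⟩
    k * suc m′      ∎))

shallow⊎deep : ∀ B {g M G} → 1 ≤ g → G ∈ subsetsUpTo B → T (isGapset G ∧ (genus G ≡ᵇ g)) →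
    T (isGapset G ∧ (genus G ≡ᵇ g) ∧ (depth G ≤ᵇ ceilDiv (2 * g) (suc M)))
  ⊎ ∃ λ m → m ∈ range 2 M × ∃ λ q → q ∈ range (suc (ceilDiv (2 * g) (suc M))) (ceilDiv (2 * g) m)
      × T (isGapset G ∧ (genus G ≡ᵇ g) ∧ (depth G ≡ᵇ q) ∧ (multiplicity G ≡ᵇ m))
shallow⊎deep B {g} {M} {G} 1≤g G∈S isG∧genus≡ᵇg
  with isG , genus≡ᵇg ← Equivalence.to T-∧ isG∧genus≡ᵇg
  with refl ← ≡ᵇ⇒≡ (length G) g genus≡ᵇg
  with depth G ≤? ceilDiv (2 * g) (suc M)
... | yes shallow = inj₁ (∧-intro isG (∧-intro genus≡ᵇg (≤⇒≤ᵇ shallow)))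
... | no deep = inj₂ (multiplicity G , ∈-range⁺ (2≤multiplicity gapset 1≤g) (deep⇒multiplicity≤ M gapset (≰⇒> deep)) ,
                      depth G , ∈-range⁺ (≰⇒> deep) (depth≤⌈2g/m⌉ gapset) ,
                      ∧-intro isG (∧-intro genus≡ᵇg
                        (∧-intro (≡⇒≡ᵇ (depth G) _ refl) (≡⇒≡ᵇ (multiplicity G) _ refl))))
  where
  gapset = isGapset⇒IsGapset B G∈S isG

theorem6p8 : (g M B : ℕ) → 1 ≤ g → 1 < M → 2 * g ≤ B →
    nGapsets B g ≤
      F (ceilDiv (2 * g) (suc M)) (suc g)
      + sumRange 2 M (λ m →
          sumRange (suc (ceilDiv (2 * g) (suc M))) (ceilDiv (2 * g) m) (λ q → countF B g q m))
theorem6p8 g M B 1≤g _ _ =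
  ≤-trans (count-cover ofGenus shallow (range 2 M) (λ m → range (suc k) (ceilDiv (2 * g) m)) withDepthAndMultiplicity
                       (subsetsUpTo B) (shallow⊎deep B 1≤g))
          (+-monoˡ-≤ _ (shallowGapsets≤F B g k))
  where
  k = ceilDiv (2 * g) (suc M)
  ofGenus shallow : List ℕ → Bool
  ofGenus G = isGapset G ∧ (genus G ≡ᵇ g)
  shallow G = isGapset G ∧ (genus G ≡ᵇ g) ∧ (depth G ≤ᵇ k)
  withDepthAndMultiplicity : ℕ → ℕ → List ℕ → Bool
  withDepthAndMultiplicity m q G = isGapset G ∧ (genus G ≡ᵇ g) ∧ (depth G ≡ᵇ q) ∧ (multiplicity G ≡ᵇ m)
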